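{- For every code retrieving function $\rho$, term $p$, state relations $R,G$ and state predicates $P,Q$: $\rho\models^{\infty}\{R,P\}\,p\,\{Q,G\}$ holds iff $\rho\models\{R,P\}\,p\,\{Q,G\}$ holds.
   Context: Program terms over a state type $\alpha$ are generated by $p::=\mathbf{skip}\mid\mathbf{basic}\,f\mid\mathbf{cjump}\,C\,i\,p\mid\mathbf{while}\,C\,p\,p\mid\mathbf{if}\,C\,p\,p\mid p;p\mid\Vert(p_1,\dots,p_m)\mid\mathbf{await}\,C\,p$ ($f:\alpha\to\alpha$, $C\subseteq\alpha$, $i\in\mathbb N$, $m\ge1$). A code retrieving function $\rho$ maps $\mathbb N$ to terms. The program step relation $\rho\vdash(p,\sigma)\to_{\mathcal P}(p',\sigma')$ is the least relation with: $(\mathbf{basic}\,f,\sigma)\to(\mathbf{skip},f\sigma)$; $(\mathbf{cjump}\,C\,i\,p,\sigma)\to(\rho\,i,\sigma)$ if $\sigma\in C$, $\to(p,\sigma)$ otherwise; $(\mathbf{await}\,C\,p,\sigma)\to(\mathbf{skip},\sigma')$ if $\sigma\in C$ and $(p,\sigma)\to^*(\mathbf{skip},\sigma')$; $(\mathbf{if}\,C\,p_1\,p_2,\sigma)\to(p_1,\sigma)$ if $\sigma\in C$, $\to(p_2,\sigma)$ otherwise; for $x=\mathbf{while}\,C\,p_1\,p_2$: $(x,\sigma)\to(p_1;(\mathbf{skip};x),\sigma)$ if $\sigma\in C$, $\to(p_2,\sigma)$ otherwise; $(p_1;p_2,\sigma)\to(p_1';p_2,\sigma')$ if $(p_1,\sigma)\to(p_1',\sigma')$;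 $(\mathbf{skip};p,\sigma)\to(p,\sigma)$; $(\Vert(\dots,p_i,\dots),\sigma)\to(\Vert(\dots,p_i',\dots),\sigma')$ if $(p_i,\sigma)\to(p_i',\sigma')$; $(\Vert(\mathbf{skip},\dots,\mathbf{skip}),\sigma)\to(\mathbf{skip},\sigma)$. A finite (resp. infinite) potential computation of $(\rho,p)$ is a nonempty finite sequence (resp. a sequence indexed by $\mathbb N$) of configurations $(p_i,\sigma_i)$ with $p_0=p$ where each transition $i\to i+1$ is a program step or an environment step ($p_{i+1}=p_i$, state arbitrary). Such a computation satisfies: the environment condition for $R$ if every environment step has $(\sigma_i,\sigma_{i+1})\in R$; the program condition for $G$ if every program step has $(\sigma_i,\sigma_{i+1})\in G$; the input condition for $P$ if $\sigma_0\in P$; the output condition for $Q$ if, whenever some $p_i=\mathbf{skip}$, the least such $i$ has $\sigma_i\in Q$. $\rho\models\{R,P\}\,p\,\{Q,G\}$ means every finite potential computation of $(\rho,p)$ satisfying the environment condition for $R$ and the input condition for $P$ satisfies the output condition for $Q$ and the program condition for $G$. $\rho\models^{\infty}\{R,P\}\,p\,\{Q,G\}$ means that $\rho\models\{R,P\}\,p\,\{Q,G\}$ holds and, in addition, the same implication holds for all infinite potential computations of $(\rho,p)$. -}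

module Defs where

open import Data.Nat using (ℕ; zero; suc; _<_; _≤_)
open import Data.Fin using (Fin)
open import Data.Vec using (Vec; lookup; _[_]≔_)
open import Data.Vec.Relation.Unary.All using (All)
open import Data.Product using (_×_; _,_; proj₁; proj₂)
open import Data.Sum using (_⊎_)
open import Data.Unit using (⊤)
open import Relation.Nullary using (¬_)
open import Relation.Binary.PropositionalEquality using (_≡_; _≢_)

data Com (α : Set) : Set₁ where
  skip  : Com α
  basic : (α → α) → Com α
  cjump : (α → Set) → ℕ → Com α → Com α
  while : (α → Set) → Com α → Com α → Com α
  if    : (α → Set) → Com α → Com α → Com α
  _⨾_   : Com α → Com α → Com α
  par   : {n : ℕ} → Vec (Com α) (suc n) → Com α
  await : (α → Set) → Com α → Com α

Conf : Set → Set₁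
Conf α = Com α × α

mutual
  data Step {α : Set} (ρ : ℕ → Com α) : Conf α → Conf α → Set₁ where
    basicS  : ∀ {f σ} → Step ρ (basic f , σ) (skip , f σ)
    cjumpT  : ∀ {C i p σ} → C σ → Step ρ (cjump C i p , σ) (ρ i , σ)
    cjumpF  : ∀ {C i p σ} → ¬ C σ → Step ρ (cjump C i p , σ) (p , σ)
    awaitS  : ∀ {C p σ σ'} → C σ → Steps ρ (p , σ) (skip , σ') →
              Step ρ (await C p , σ) (skip , σ')
    ifT     : ∀ {C p₁ p₂ σ} → C σ → Step ρ (if C p₁ p₂ , σ) (p₁ , σ)
    ifF     : ∀ {C p₁ p₂ σ} → ¬ C σ → Step ρ (if C p₁ p₂ , σ) (p₂ , σ)
    whileT  : ∀ {C p₁ p₂ σ} → C σ →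
              Step ρ (while C p₁ p₂ , σ) (p₁ ⨾ (skip ⨾ while C p₁ p₂) , σ)
    whileF  : ∀ {C p₁ p₂ σ} → ¬ C σ → Step ρ (while C p₁ p₂ , σ) (p₂ , σ)
    seqS    : ∀ {p₁ p₁' p₂ σ σ'} → Step ρ (p₁ , σ) (p₁' , σ') →
              Step ρ (p₁ ⨾ p₂ , σ) (p₁' ⨾ p₂ , σ')
    seqSkip : ∀ {p σ} → Step ρ (skip ⨾ p , σ) (p , σ)
    parS    : ∀ {n} {ps : Vec (Com α) (suc n)} {q σ σ'} (i : Fin (suc n)) →
              Step ρ (lookup ps i , σ) (q , σ') →
              Step ρ (par ps , σ) (par (ps [ i ]≔ q) , σ')
    parSkip : ∀ {n} {ps : Vec (Com α) (suc n)} {σ} → All (_≡ skip) ps →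
              Step ρ (par ps , σ) (skip , σ)

  data Steps {α : Set} (ρ : ℕ → Com α) : Conf α → Conf α → Set₁ where
    done : ∀ {c} → Steps ρ c c
    more : ∀ {c d e} → Step ρ c d → Steps ρ d e → Steps ρ c e

EnvStep : {α : Set} → Conf α → Conf α → Set₁
EnvStep c d = proj₁ d ≡ proj₁ c

-- A potential computation is a sequence c : ℕ → Conf α.  A finite one of
-- length k+1 uses only the positions 0..k (positions > k are irrelevant);
-- an infinite one uses all positions.  "InT i" says that the transition
-- i → i+1 belongs to the sequence, "InC i" that configuration i does.

IsPotComp : {α : Set} → (ℕ → Com α) → Com α → (ℕ → Set) → (ℕ → Conf α) → Set₁
IsPotComp ρ p InT c =
  proj₁ (c 0) ≡ p ×
  (∀ i → InT i → Step ρ (c i) (c (suc i)) ⊎ EnvStep (c i) (c (suc i)))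

EnvCond : {α : Set} → (α → α → Set) → (ℕ → Set) → (ℕ → Conf α) → Set₁
EnvCond R InT c =
  ∀ i → InT i → EnvStep (c i) (c (suc i)) → R (proj₂ (c i)) (proj₂ (c (suc i)))

ProgCond : {α : Set} → (ℕ → Com α) → (α → α → Set) → (ℕ → Set) → (ℕ → Conf α) → Set₁
ProgCond ρ G InT c =
  ∀ i → InT i → Step ρ (c i) (c (suc i)) → G (proj₂ (c i)) (proj₂ (c (suc i)))

InputCond : {α : Set} → (α → Set) → (ℕ → Conf α) → Set
InputCond P c = P (proj₂ (c 0))

OutputCond : {α : Set} → (α → Set) → (ℕ → Set) → (ℕ → Conf α) → Set₁
OutputCond Q InC c =
  ∀ i → InC i → proj₁ (c i) ≡ skip → (∀ j → j < i → proj₁ (c j) ≢ skip) →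
  Q (proj₂ (c i))

SatisfiesSpec : {α : Set} → (ℕ → Com α) → (α → α → Set) → (α → Set) → Com α →
                (α → Set) → (α → α → Set) → (ℕ → Set) → (ℕ → Set) →
                (ℕ → Conf α) → Set₁
SatisfiesSpec ρ R P p Q G InT InC c =
  IsPotComp ρ p InT c → EnvCond R InT c → InputCond P c →
  OutputCond Q InC c × ProgCond ρ G InT c

Valid : {α : Set} → (ℕ → Com α) → (α → α → Set) → (α → Set) → Com α →
        (α → Set) → (α → α → Set) → Set₁
Valid {α} ρ R P p Q G =
  ∀ (k : ℕ) (c : ℕ → Conf α) → SatisfiesSpec ρ R P p Q G (_< k) (_≤ k) c

ValidInf : {α : Set} → (ℕ → Com α) → (α → α → Set) → (α → Set) → Com α →
           (α → Set) → (α → α → Set) → Set₁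
ValidInf {α} ρ R P p Q G =
  Valid ρ R P p Q G ×
  (∀ (c : ℕ → Conf α) → SatisfiesSpec ρ R P p Q G (λ _ → ⊤) (λ _ → ⊤) c)

-- A condition violated by an infinite computation is already violated by
-- one of its finite prefixes: the output condition at position i only
-- involves the prefix of length i + 1, and the program condition at the
-- transition i → i + 1 only the prefix of length i + 2.  Hence finite
-- validity already controls every infinite computation.
module Submission where

open import Defs
open import Data.Nat using (ℕ; suc; _<_; _≤_)
open import Data.Nat.Properties using (≤-refl; n<1+n)
open import Data.Product using (_×_; _,_; proj₁; proj₂)
open import Data.Unit using (⊤; tt)

module _ {α : Set} {InT InT′ : ℕ → Set} (InT′⊆InT : ∀ i → InT′ i → InT i) where

  IsPotComp-antimono : ∀ {ρ : ℕ → Com α} {p c} →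
                       IsPotComp ρ p InT c → IsPotComp ρ p InT′ c
  IsPotComp-antimono (start , step) = start , λ i t → step i (InT′⊆InT i t)

  EnvCond-antimono : ∀ {R : α → α → Set} {c} → EnvCond R InT c → EnvCond R InT′ c
  EnvCond-antimono env i t = env i (InT′⊆InT i t)

Valid⇒ValidInf : ∀ {α} (ρ : ℕ → Com α) R P p Q G →
                 Valid ρ R P p Q G → ValidInf ρ R P p Q G
Valid⇒ValidInf ρ R P p Q G valid = valid , infinite
  where
  infinite : ∀ c → SatisfiesSpec ρ R P p Q G (λ _ → ⊤) (λ _ → ⊤) c
  infinite c comp env input = output , program
    where
    prefix : ∀ k → OutputCond Q (_≤ k) c × ProgCond ρ G (_< k) c
    prefix k = valid k c (IsPotComp-antimono (λ _ _ → tt) comp)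
                         (EnvCond-antimono (λ _ _ → tt) {R} env) input

    output : OutputCond Q (λ _ → ⊤) c
    output i _ = proj₁ (prefix i) i ≤-refl

    program : ProgCond ρ G (λ _ → ⊤) c
    program i _ = proj₂ (prefix (suc i)) i (n<1+n i)

mainTheorem14 : {α : Set} (ρ : ℕ → Com α) (p : Com α) (R G : α → α → Set) (P Q : α → Set) →
    (ValidInf ρ R P p Q G → Valid ρ R P p Q G) × (Valid ρ R P p Q G → ValidInf ρ R P p Q G)
mainTheorem14 ρ p R G P Q = proj₁ , Valid⇒ValidInf ρ R P p Q G
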